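{- Let $r\ge 0$ be an integer and let $G$ be a finite graph on $n$ vertices with maximum degree $\Delta(G)\leq 2r+1$. Let $\tau$ be a threshold assignment with $\tau(v)\geq r+1$ for every vertex $v$. If $D$ is a $\tau$-WDM of $G$ with processing time $t$, then $$\frac{n}{2r+2-(2r+1)\left(\frac{r}{r+1}\right)^t}\leq |D|.$$
   Context: All graphs are finite and simple. A threshold assignment is a function $\tau:V(G)\to\mathbb{Z}_{\ge0}$. A set $D\subseteq V(G)$ is a $\tau$-weak dynamic monopoly ($\tau$-WDM) with processing time $t$ if $V(G)$ can be partitioned into $D_0=D,D_1,\ldots,D_t$ such that for every $i\in\{1,\ldots,t\}$, every vertex $v\in D_i$ has at least $\tau(v)$ neighbors in $D_{i-1}$. (Convention $0^0=1$.) -}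

module Defs where

open import Data.Bool using (Bool; true; false; _∧_)
open import Data.Nat as ℕ using (ℕ; zero; suc; _≡ᵇ_)
import Data.Nat.Properties as ℕP
open import Data.Fin using (Fin)
open import Data.Fin.Subset using (Subset; _∈_; ∣_∣)
open import Data.Vec using (tabulate)
open import Data.Integer as ℤ using (+_)
import Data.Integer.Properties as ℤP
open import Data.Rational as ℚ using (ℚ; 0ℚ; 1ℚ; _+_; _*_; _-_; -_; _≤_; _<_; _/_; NonZero; NonNegative; Positive)
import Data.Rational.Properties as ℚP
import Data.Rational.Unnormalised as ℚᵘ
import Data.Rational.Unnormalised.Properties as ℚᵘP
open import Data.Product using (Σ; _×_; _,_)
open import Function.Bundles using (_⇔_)
open import Relation.Binary.PropositionalEquality using (_≡_; refl; sym; subst; subst₂)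

record Graph (n : ℕ) : Set where
  field
    adj        : Fin n → Fin n → Bool
    adj-sym    : ∀ u v → adj u v ≡ adj v u
    adj-irrefl : ∀ v → adj v v ≡ false

open Graph public

degree : ∀ {n} → Graph n → Fin n → ℕ
degree G v = ∣ tabulate (adj G v) ∣

MaxDegree≤ : ∀ {n} → Graph n → ℕ → Set
MaxDegree≤ G k = ∀ v → degree G v ℕ.≤ k

Threshold : ℕ → Set
Threshold n = Fin n → ℕ

nbrsInLayer : ∀ {n} → Graph n → (Fin n → ℕ) → Fin n → ℕ → ℕ
nbrsInLayer G L v i = ∣ tabulate (λ u → adj G v u ∧ (L u ≡ᵇ i)) ∣

-- D is a τ-WDM of G with processing time t: V(G) is partitioned into
-- D_0 = D, D_1, ..., D_t, encoded by a layer function L (v ∈ D_i iff L v = i),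
-- such that every v ∈ D_i (1 ≤ i ≤ t) has ≥ τ(v) neighbours in D_{i-1}.
IsWDM : ∀ {n} → Graph n → Threshold n → Subset n → ℕ → Set
IsWDM {n} G τ D t =
  Σ (Fin n → ℕ) λ L →
    (∀ v → L v ℕ.≤ t) ×
    (∀ v → (v ∈ D) ⇔ (L v ≡ 0)) ×
    (∀ v i → L v ≡ suc i → τ v ℕ.≤ nbrsInLayer G L v i)

-- natural number power on ℚ (so q ^ 0 = 1, in particular 0^0 = 1)
_^ℚ_ : ℚ → ℕ → ℚ
q ^ℚ zero  = 1ℚ
q ^ℚ suc t = q * (q ^ℚ t)

ℕ→ℚ : ℕ → ℚ
ℕ→ℚ m = + m / 1

denom : ℕ → ℕ → ℚ
denom r t = ℕ→ℚ (2 ℕ.* r ℕ.+ 2) - ℕ→ℚ (2 ℕ.* r ℕ.+ 1) * ((+ r / suc r) ^ℚ t)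

private
  q≥0 : ∀ r → NonNegative (+ r / suc r)
  q≥0 r = ℚP.normalize-nonNeg r (suc r)

  q≤1 : ∀ r → (+ r / suc r) ≤ 1ℚ
  q≤1 r = ℚP.toℚᵘ-cancel-≤
    (ℚᵘP.≤-respˡ-≃ (ℚᵘP.≃-sym (ℚP.toℚᵘ-fromℚᵘ (ℚᵘ.mkℚᵘ (+ r) r)))
      (ℚᵘ.*≤* (subst₂ ℤ._≤_ (sym (ℤP.*-identityʳ (+ r))) (sym (ℤP.*-identityˡ (+ suc r)))
                 (ℤ.+≤+ (ℕP.n≤1+n r)))))

  pow≤1 : ∀ q → .{{NonNegative q}} → q ≤ 1ℚ → ∀ t → (q ^ℚ t) ≤ 1ℚ
  pow≤1 q q≤ zero = ℚP.≤-refl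
  pow≤1 q q≤ (suc t) = ℚP.≤-trans
    (ℚP.*-monoˡ-≤-nonNeg q (pow≤1 q q≤ t))
    (subst (_≤ 1ℚ) (sym (ℚP.*-identityʳ q)) q≤)

  denom>0 : ∀ r t → 0ℚ < denom r t
  denom>0 r t = subst (_< denom r t) (ℚP.+-inverseʳ x) (ℚP.+-monoˡ-< (- x) x<c)
    where
      q = + r / suc r
      x = ℕ→ℚ (2 ℕ.* r ℕ.+ 1) * (q ^ℚ t)
      x≤k : x ≤ ℕ→ℚ (2 ℕ.* r ℕ.+ 1)
      x≤k = ℚP.≤-trans
        (ℚP.*-monoˡ-≤-nonNeg (ℕ→ℚ (2 ℕ.* r ℕ.+ 1)) {{ℚP.normalize-nonNeg (2 ℕ.* r ℕ.+ 1) 1}}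
          (pow≤1 q {{q≥0 r}} (q≤1 r) t))
        (ℚP.≤-reflexive (ℚP.*-identityʳ _))
      k<c : ℕ→ℚ (2 ℕ.* r ℕ.+ 1) < ℕ→ℚ (2 ℕ.* r ℕ.+ 2)
      k<c = ℚP.toℚᵘ-cancel-<
        (ℚᵘP.<-respʳ-≃ (ℚᵘP.≃-sym (ℚP.toℚᵘ-fromℚᵘ (ℚᵘ.mkℚᵘ (+ (2 ℕ.* r ℕ.+ 2)) 0)))
          (ℚᵘP.<-respˡ-≃ (ℚᵘP.≃-sym (ℚP.toℚᵘ-fromℚᵘ (ℚᵘ.mkℚᵘ (+ (2 ℕ.* r ℕ.+ 1)) 0)))
            (ℚᵘ.*<* (subst₂ ℤ._<_ (sym (ℤP.*-identityʳ _)) (sym (ℤP.*-identityʳ _))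
                   (ℤ.+<+ (ℕP.+-monoʳ-< (2 ℕ.* r) (ℕ.s≤s (ℕ.s≤s ℕ.z≤n))))))))
      x<c : x < ℕ→ℚ (2 ℕ.* r ℕ.+ 2)
      x<c = ℚP.≤-<-trans x≤k k<c

denom-nonZero : ∀ r t → NonZero (denom r t)
denom-nonZero r t = ℚ.>-nonZero (denom>0 r t)

bound : ℕ → ℕ → ℕ → ℚ
bound n r t = ℚ._÷_ (ℕ→ℚ n) (denom r t) {{denom-nonZero r t}}

module Submission where

-- Let D = D₀, D₁, …, D_t be the layers of a τ-WDM and dᵢ = |Dᵢ|.  The proof
-- double counts the edges between two consecutive layers Dᵢ, Dᵢ₊₁:
--
--   * every vertex of D₁ has ≥ r+1 neighbours in D₀, every vertex of D₀ has
--     ≤ 2r+1 neighbours in D₁, so (r+1) d₁ ≤ (2r+1) d₀;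
--   * every vertex of D_{k+2} has ≥ r+1 neighbours in D_{k+1}, and a vertex of
--     D_{k+1} already has ≥ r+1 of its ≤ 2r+1 neighbours in D_k, hence ≤ r in
--     D_{k+2}; so (r+1) d_{k+2} ≤ r d_{k+1}.
--
-- Thus d₁, d₂, … decays geometrically with ratio q = r/(r+1), and summing the
-- geometric series gives  n = d₀ + d₁ + … + d_t ≤ d₀ (1 + (2r+1)(1 - qᵗ)),
-- which is d₀ times the denominator of the bound.

open import Defs
open import Data.Nat as ℕ using (ℕ; suc)
open import Data.Fin.Subset using (Subset; ∣_∣)
open import Data.Rational as ℚ using (_≤_)

open import Data.Fin using (Fin; zero; suc; toℕ)
open import Data.Product using (_,_)
open import Function.Bundles using (_⇔_; Equivalence)
open import Relation.Binary.PropositionalEquality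
  using (_≡_; refl; sym; trans; cong; cong₂; subst; subst₂; module ≡-Reasoning)

module Counting where
  open import Data.Bool using (Bool; true; false; _∧_; T)
  open import Data.Bool.Properties using (T-≡)
  open import Data.Empty using (⊥-elim)
  open import Data.Nat using (zero; _+_; _*_; _≡ᵇ_; z≤n; s≤s)
  open import Data.Nat.Properties
  open import Data.Nat.Tactic.RingSolver using (solve-∀)
  open import Data.Fin.Subset using (_∈_)
  open import Data.Vec using (tabulate; lookup)
  open import Data.Vec.Properties using (tabulate∘lookup; []=⇒lookup; lookup⇒[]=)
  open import Relation.Nullary using (¬_)
  open import Algebra.Properties.Semiring.Sum +-*-semiring public

  iverson : Bool → ℕ
  iverson true  = 1
  iverson false = 0

  iverson≤1 : ∀ b → iverson b ℕ.≤ 1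
  iverson≤1 true  = ≤-refl
  iverson≤1 false = z≤n

  iverson-cong : ∀ {b c} → (T b → T c) → (T c → T b) → iverson b ≡ iverson c
  iverson-cong {false} {false} _   _   = refl
  iverson-cong {false} {true}  _   c⇒b = ⊥-elim (c⇒b _)
  iverson-cong {true}  {false} b⇒c _   = ⊥-elim (b⇒c _)
  iverson-cong {true}  {true}  _   _   = refl

  ≡ᵇ-true : ∀ m n → (m ≡ᵇ n) ≡ true → m ≡ n
  ≡ᵇ-true m n eq = ≡ᵇ⇒≡ m n (Equivalence.from T-≡ eq)

  sum-mono-≤ : ∀ {m} {f g : Fin m → ℕ} → (∀ i → f i ℕ.≤ g i) → sum f ℕ.≤ sum g
  sum-mono-≤ {zero}  f≤g = z≤n
  sum-mono-≤ {suc m} f≤g = +-mono-≤ (f≤g zero) (sum-mono-≤ (λ i → f≤g (suc i)))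

  sum-ones : ∀ m → ∑[ i < m ] 1 ≡ m
  sum-ones zero    = refl
  sum-ones (suc m) = cong suc (sum-ones m)

  card-tabulate : ∀ {m} (f : Fin m → Bool) → ∣ tabulate f ∣ ≡ ∑[ i < m ] iverson (f i)
  card-tabulate {zero}  f = refl
  card-tabulate {suc m} f with f zero
  ... | true  = cong suc (card-tabulate (λ i → f (suc i)))
  ... | false = card-tabulate (λ i → f (suc i))

  unique-layer : ∀ l m → l ℕ.≤ m → ∑[ i < suc m ] iverson (l ≡ᵇ toℕ i) ≡ 1
  unique-layer zero    m       _       = cong suc (sum-replicate-zero m)
  unique-layer (suc l) (suc m) (s≤s h) = unique-layer l m h

  remaining≤ : ∀ {r a b} → suc r ℕ.≤ a → a + b ℕ.≤ 2 * r + 1 → b ℕ.≤ r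
  remaining≤ {r} {a} {b} r<a a+b≤ = +-cancelˡ-≤ (suc r) b r (begin
      suc r + b  ≤⟨ +-monoˡ-≤ b r<a ⟩
      a + b      ≤⟨ a+b≤ ⟩
      2 * r + 1  ≡⟨ double+1 r ⟩
      suc r + r  ∎)
    where
      open ≤-Reasoning
      double+1 : ∀ r → 2 * r + 1 ≡ suc r + r
      double+1 = solve-∀

  module Layering {n : ℕ} (G : Graph n) (L : Fin n → ℕ) where

    inLayer : Fin n → ℕ → ℕ
    inLayer v i = iverson (L v ≡ᵇ i)

    layerSize : ℕ → ℕ
    layerSize i = ∑[ v < n ] inLayer v i

    layerSum : ℕ → (Fin n → ℕ) → ℕ
    layerSum i f = ∑[ v < n ] (inLayer v i * f v)

    layerSum-mono : ∀ i {f g : Fin n → ℕ} → (∀ v → L v ≡ i → f v ℕ.≤ g v) →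
                    layerSum i f ℕ.≤ layerSum i g
    layerSum-mono i {f} {g} f≤g = sum-mono-≤ pointwise
      where
        pointwise : ∀ v → inLayer v i * f v ℕ.≤ inLayer v i * g v
        pointwise v with L v ≡ᵇ i in eq
        ... | true  = +-monoˡ-≤ 0 (f≤g v (≡ᵇ-true (L v) i eq))
        ... | false = z≤n

    layerSum-const : ∀ i c → layerSum i (λ _ → c) ≡ c * layerSize i
    layerSum-const i c =
      trans (sum-cong-≗ (λ v → *-comm (inLayer v i) c)) (sym (*-distribˡ-sum c (λ v → inLayer v i)))

    partition : ∀ {t} → (∀ v → L v ℕ.≤ t) → n ≡ ∑[ i < suc t ] layerSize (toℕ i)
    partition {t} L≤t = begin
      n                                           ≡⟨ sum-ones n ⟨
      ∑[ v < n ] 1                                ≡⟨ sum-cong-≗ (λ v → unique-layer (L v) t (L≤t v)) ⟨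
      ∑[ v < n ] (∑[ i < suc t ] inLayer v (toℕ i)) ≡⟨ ∑-comm {n} {suc t} (λ v i → inLayer v (toℕ i)) ⟩
      ∑[ i < suc t ] layerSize (toℕ i)            ∎
      where open ≡-Reasoning

    adjacent : Fin n → Fin n → ℕ
    adjacent v u = iverson (adj G v u)

    nbrs : Fin n → ℕ → ℕ
    nbrs = nbrsInLayer G L

    nbrs-sum : ∀ v i → nbrs v i ≡ ∑[ u < n ] (adjacent v u * inLayer u i)
    nbrs-sum v i = trans (card-tabulate (λ u → adj G v u ∧ (L u ≡ᵇ i)))
                         (sum-cong-≗ (λ u → iverson-∧ (adj G v u) _))
      where
        iverson-∧ : ∀ x y → iverson (x ∧ y) ≡ iverson x * iverson y
        iverson-∧ true  y = sym (+-identityʳ _)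
        iverson-∧ false y = refl

    nbrs-disjoint : ∀ v {a b} → ¬ a ≡ b → nbrs v a + nbrs v b ℕ.≤ degree G v
    nbrs-disjoint v {a} {b} a≢b = begin
      nbrs v a + nbrs v b
        ≡⟨ cong₂ _+_ (card-tabulate (inLayerAdj a)) (card-tabulate (inLayerAdj b)) ⟩
      sum (λ u → iverson (inLayerAdj a u)) + sum (λ u → iverson (inLayerAdj b u))
        ≡⟨ ∑-distrib-+ (λ u → iverson (inLayerAdj a u)) (λ u → iverson (inLayerAdj b u)) ⟨
      ∑[ u < n ] (iverson (inLayerAdj a u) + iverson (inLayerAdj b u))
        ≤⟨ sum-mono-≤ (λ u → pointwise (adj G v u) (L u)) ⟩
      ∑[ u < n ] adjacent v u
        ≡⟨ card-tabulate (adj G v) ⟨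
      degree G v ∎
      where
        open ≤-Reasoning
        inLayerAdj : ℕ → Fin n → Bool
        inLayerAdj i u = adj G v u ∧ (L u ≡ᵇ i)
        pointwise : ∀ x l → iverson (x ∧ (l ≡ᵇ a)) + iverson (x ∧ (l ≡ᵇ b)) ℕ.≤ iverson x
        pointwise false l = z≤n
        pointwise true  l with l ≡ᵇ a in la | l ≡ᵇ b in lb
        ... | true  | true  = ⊥-elim (a≢b (trans (sym (≡ᵇ-true l a la)) (≡ᵇ-true l b lb)))
        ... | true  | false = ≤-refl
        ... | false | y     = iverson≤1 y

    -- Both sides count the pairs (v, u) of adjacent vertices with v in layer j, u in layer i.
    edges-sym : ∀ i j → layerSum j (λ v → nbrs v i) ≡ layerSum i (λ u → nbrs u j)
    edges-sym i j = begin
      layerSum j (λ v → nbrs v i)                                  ≡⟨ as-double-sum j i ⟩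
      ∑[ v < n ] (∑[ u < n ] (inLayer v j * adjacent v u * inLayer u i)) ≡⟨ ∑-comm (λ v u → inLayer v j * adjacent v u * inLayer u i) ⟩
      ∑[ u < n ] (∑[ v < n ] (inLayer v j * adjacent v u * inLayer u i))
        ≡⟨ sum-cong-≗ (λ u → sum-cong-≗ (λ v → flip-edge u v)) ⟩
      ∑[ u < n ] (∑[ v < n ] (inLayer u i * adjacent u v * inLayer v j)) ≡⟨ as-double-sum i j ⟨
      layerSum i (λ u → nbrs u j)                                  ∎
      where
        open ≡-Reasoning
        as-double-sum : ∀ j i →
          layerSum j (λ v → nbrs v i) ≡ ∑[ v < n ] (∑[ u < n ] (inLayer v j * adjacent v u * inLayer u i))
        as-double-sum j i = sum-cong-≗ λ v → begin
          inLayer v j * nbrs v i                                     ≡⟨ cong (inLayer v j *_) (nbrs-sum v i) ⟩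
          inLayer v j * ∑[ u < n ] (adjacent v u * inLayer u i)        ≡⟨ *-distribˡ-sum (inLayer v j) (λ u → adjacent v u * inLayer u i) ⟩
          ∑[ u < n ] (inLayer v j * (adjacent v u * inLayer u i))      ≡⟨ sum-cong-≗ (λ u → *-assoc (inLayer v j) (adjacent v u) (inLayer u i)) ⟨
          ∑[ u < n ] (inLayer v j * adjacent v u * inLayer u i)      ∎
        reverse : ∀ x y z → x * y * z ≡ z * y * x
        reverse = solve-∀
        flip-edge : ∀ u v → inLayer v j * adjacent v u * inLayer u i ≡ inLayer u i * adjacent u v * inLayer v j
        flip-edge u v = trans (cong (λ e → inLayer v j * iverson e * inLayer u i) (adj-sym G v u))
                              (reverse (inLayer v j) (adjacent u v) (inLayer u i))

    layer-ratio : ∀ i a b →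
      (∀ v → L v ≡ suc i → a ℕ.≤ nbrs v i) →
      (∀ v → L v ≡ i → nbrs v (suc i) ℕ.≤ b) →
      a * layerSize (suc i) ℕ.≤ b * layerSize i
    layer-ratio i a b many few = begin
      a * layerSize (suc i)              ≡⟨ layerSum-const (suc i) a ⟨
      layerSum (suc i) (λ _ → a)         ≤⟨ layerSum-mono (suc i) many ⟩
      layerSum (suc i) (λ v → nbrs v i)  ≡⟨ edges-sym i (suc i) ⟩
      layerSum i (λ u → nbrs u (suc i))  ≤⟨ layerSum-mono i few ⟩
      layerSum i (λ _ → b)               ≡⟨ layerSum-const i b ⟩
      b * layerSize i                    ∎
      where open ≤-Reasoning

    card-seed : (D : Subset n) → (∀ v → (v ∈ D) ⇔ (L v ≡ 0)) → ∣ D ∣ ≡ layerSize 0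
    card-seed D seed = begin
      ∣ D ∣                             ≡⟨ cong ∣_∣ (tabulate∘lookup D) ⟨
      ∣ tabulate (lookup D) ∣           ≡⟨ card-tabulate (lookup D) ⟩
      ∑[ v < n ] iverson (lookup D v)   ≡⟨ sum-cong-≗ (λ v → iverson-cong (to v) (from v)) ⟩
      layerSize 0                       ∎
      where
        open ≡-Reasoning
        to : ∀ v → T (lookup D v) → T (L v ≡ᵇ 0)
        to v p = ≡⇒≡ᵇ (L v) 0 (Equivalence.to (seed v) (lookup⇒[]= v D (Equivalence.to T-≡ p)))
        from : ∀ v → T (L v ≡ᵇ 0) → T (lookup D v)
        from v p = Equivalence.from T-≡
          ([]=⇒lookup (Equivalence.from (seed v) (≡ᵇ⇒≡ (L v) 0 p)))

    module Decay {r : ℕ} (τ : Threshold n)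
      (maxdeg : MaxDegree≤ G (2 * r + 1))
      (thr : ∀ v → suc r ℕ.≤ τ v)
      (step : ∀ v i → L v ≡ suc i → τ v ℕ.≤ nbrs v i) where

      enough : ∀ v i → L v ≡ suc i → suc r ℕ.≤ nbrs v i
      enough v i eq = ≤-trans (thr v) (step v i eq)

      -- A vertex of layer 0 has at most 2r+1 neighbours in layer 1.
      decay₀ : suc r * layerSize 1 ℕ.≤ (2 * r + 1) * layerSize 0
      decay₀ = layer-ratio 0 (suc r) (2 * r + 1) (λ v → enough v 0)
        (λ v _ → ≤-trans (m+n≤o⇒n≤o (nbrs v 0) (nbrs-disjoint v (λ ()))) (maxdeg v))

      -- A vertex of layer k+1 has ≥ r+1 neighbours in layer k, so ≤ r in layer k+2.
      decay : ∀ k → suc r * layerSize (suc (suc k)) ℕ.≤ r * layerSize (suc k)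
      decay k = layer-ratio (suc k) (suc r) r (λ v → enough v (suc k))
        (λ v eq → remaining≤ (enough v k eq)
                             (≤-trans (nbrs-disjoint v {k} {suc (suc k)} (λ ())) (maxdeg v)))

module Rational where
  open import Data.Integer as ℤ using (+_; ℤ)
  import Data.Integer.Properties as ℤP
  open import Data.Integer.Tactic.RingSolver using () renaming (solve-∀ to ℤ-solve-∀)
  import Data.Nat.Properties as ℕP
  open import Data.Rational
    using (ℚ; 0ℚ; 1ℚ; _+_; _*_; _-_; _/_; _÷_; 1/_; toℚᵘ; NonNegative; Positive; nonNegative)
  open import Data.Rational.Properties
  open import Data.Rational.Unnormalised as ℚᵘ using (mkℚᵘ; *≡*; *≤*)
  import Data.Rational.Unnormalised.Properties as ℚᵘP
  open import Data.Rational.Solver using (module +-*-Solver)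
  open import Algebra.Bundles using (CommutativeRing)
  open import Algebra.Properties.Semiring.Sum (CommutativeRing.semiring +-*-commutativeRing)
    using () renaming (sum to sumℚ)
  open Counting using (sum)

  ℕ→ℚ-toℚᵘ : ∀ a → toℚᵘ (ℕ→ℚ a) ℚᵘ.≃ mkℚᵘ (+ a) 0
  ℕ→ℚ-toℚᵘ a = toℚᵘ-fromℚᵘ (mkℚᵘ (+ a) 0)

  ℕ→ℚ-+ : ∀ a b → ℕ→ℚ (a ℕ.+ b) ≡ ℕ→ℚ a + ℕ→ℚ b
  ℕ→ℚ-+ a b = toℚᵘ-injective (ℚᵘP.≃-trans (ℕ→ℚ-toℚᵘ (a ℕ.+ b)) (ℚᵘP.≃-trans
    (*≡* (trans (cong (ℤ._* + 1) (ℤP.pos-+ a b)) (over-one (+ a) (+ b))))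
    (ℚᵘP.≃-sym (ℚᵘP.≃-trans (toℚᵘ-homo-+ (ℕ→ℚ a) (ℕ→ℚ b)) (ℚᵘP.+-cong (ℕ→ℚ-toℚᵘ a) (ℕ→ℚ-toℚᵘ b))))))
    where
      over-one : ∀ (x y : ℤ) → (x ℤ.+ y) ℤ.* + 1 ≡ (x ℤ.* + 1 ℤ.+ y ℤ.* + 1) ℤ.* + 1
      over-one = ℤ-solve-∀

  ℕ→ℚ-* : ∀ a b → ℕ→ℚ (a ℕ.* b) ≡ ℕ→ℚ a * ℕ→ℚ b
  ℕ→ℚ-* a b = toℚᵘ-injective (ℚᵘP.≃-trans (ℕ→ℚ-toℚᵘ (a ℕ.* b)) (ℚᵘP.≃-trans
    (*≡* (cong (ℤ._* + 1) (ℤP.pos-* a b)))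
    (ℚᵘP.≃-sym (ℚᵘP.≃-trans (toℚᵘ-homo-* (ℕ→ℚ a) (ℕ→ℚ b)) (ℚᵘP.*-cong (ℕ→ℚ-toℚᵘ a) (ℕ→ℚ-toℚᵘ b))))))

  ℕ→ℚ-mono-≤ : ∀ {a b} → a ℕ.≤ b → ℕ→ℚ a ≤ ℕ→ℚ b
  ℕ→ℚ-mono-≤ {a} {b} a≤b = toℚᵘ-cancel-≤
    (ℚᵘP.≤-respˡ-≃ (ℚᵘP.≃-sym (ℕ→ℚ-toℚᵘ a)) (ℚᵘP.≤-respʳ-≃ (ℚᵘP.≃-sym (ℕ→ℚ-toℚᵘ b))
      (*≤* (subst₂ ℤ._≤_ (sym (ℤP.*-identityʳ (+ a))) (sym (ℤP.*-identityʳ (+ b))) (ℤ.+≤+ a≤b)))))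

  ℕ→ℚ-sum : ∀ {m} (f : Fin m → ℕ) → ℕ→ℚ (sum f) ≡ sumℚ (λ i → ℕ→ℚ (f i))
  ℕ→ℚ-sum {ℕ.zero} f = refl
  ℕ→ℚ-sum {suc m}  f =
    trans (ℕ→ℚ-+ (f zero) (sum (λ i → f (suc i)))) (cong (λ s → ℕ→ℚ (f zero) + s) (ℕ→ℚ-sum (λ i → f (suc i))))

  ℕ→ℚ-nonNeg : ∀ a → NonNegative (ℕ→ℚ a)
  ℕ→ℚ-nonNeg a = normalize-nonNeg a 1

  ratio : ℕ → ℚ
  ratio r = + r / suc r

  ratio-nonNeg : ∀ r → NonNegative (ratio r)
  ratio-nonNeg r = normalize-nonNeg r (suc r)

  ratio-* : ∀ r → ratio r * ℕ→ℚ (suc r) ≡ ℕ→ℚ r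
  ratio-* r = toℚᵘ-injective (ℚᵘP.≃-trans (toℚᵘ-homo-* (ratio r) (ℕ→ℚ (suc r)))
    (ℚᵘP.≃-trans (ℚᵘP.*-cong (toℚᵘ-fromℚᵘ (mkℚᵘ (+ r) r)) (ℕ→ℚ-toℚᵘ (suc r)))
    (ℚᵘP.≃-trans (*≡* cross) (ℚᵘP.≃-sym (ℕ→ℚ-toℚᵘ r)))))
    where
      cross : (+ r ℤ.* + suc r) ℤ.* + 1 ≡ + r ℤ.* + (suc r ℕ.* 1)
      cross = trans (ℤP.*-identityʳ _) (cong (λ k → + r ℤ.* + k) (sym (ℕP.*-identityʳ (suc r))))

  ratio≤1 : ∀ r → ratio r ≤ 1ℚ
  ratio≤1 r = *-cancelʳ-≤-pos (ℕ→ℚ (suc r)) {{normalize-pos (suc r) 1}}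
    (subst₂ _≤_ (sym (ratio-* r)) (sym (*-identityˡ (ℕ→ℚ (suc r)))) (ℕ→ℚ-mono-≤ (ℕP.n≤1+n r)))

  ratio-complement : ∀ r → ℕ→ℚ (suc r) * (1ℚ - ratio r) ≡ 1ℚ
  ratio-complement r = begin
    S * (1ℚ - ratio r)   ≡⟨ expand S (ratio r) ⟩
    S - ratio r * S      ≡⟨ cong (λ x → S - x) (ratio-* r) ⟩
    S - ℕ→ℚ r            ≡⟨ cong (λ x → x - ℕ→ℚ r) (ℕ→ℚ-+ 1 r) ⟩
    1ℚ + ℕ→ℚ r - ℕ→ℚ r   ≡⟨ cancel (ℕ→ℚ r) ⟩
    1ℚ                   ∎
    where
      open ≡-Reasoning
      open +-*-Solver
      S = ℕ→ℚ (suc r)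
      expand : ∀ s q → s * (1ℚ - q) ≡ s - q * s
      expand = solve 2 (λ s q → s :* (con 1ℚ :- q) := s :- q :* s) refl
      cancel : ∀ x → 1ℚ + x - x ≡ 1ℚ
      cancel = solve 1 (λ x → con 1ℚ :+ x :- x := con 1ℚ) refl

  pow≤1 : ∀ q .{{_ : NonNegative q}} → q ≤ 1ℚ → ∀ m → q ^ℚ m ≤ 1ℚ
  pow≤1 q q≤1 ℕ.zero    = ≤-refl
  pow≤1 q q≤1 (suc m) = ≤-trans (*-monoˡ-≤-nonNeg q (pow≤1 q q≤1 m))
                                (subst (_≤ 1ℚ) (sym (*-identityʳ q)) q≤1)

  pow-complement-nonNeg : ∀ q .{{_ : NonNegative q}} → q ≤ 1ℚ → ∀ m → NonNegative (1ℚ - q ^ℚ m)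
  pow-complement-nonNeg q q≤1 m = nonNegative
    (subst (_≤ 1ℚ - q ^ℚ m) (+-inverseʳ 1ℚ) (+-monoʳ-≤ 1ℚ (neg-antimono-≤ (pow≤1 q q≤1 m))))

  geometric-sum : ∀ q .{{_ : NonNegative q}} → q ≤ 1ℚ → (e : ℕ → ℚ) →
                  (∀ j → e (suc j) ≤ q * e j) →
                  ∀ m → (1ℚ - q) * sumℚ (λ (j : Fin m) → e (toℕ j)) ≤ e 0 * (1ℚ - q ^ℚ m)
  geometric-sum q q≤1 e decay ℕ.zero = ≤-reflexive (vanish q (e 0))
    where
      open +-*-Solver
      vanish : ∀ q e₀ → (1ℚ - q) * 0ℚ ≡ e₀ * (1ℚ - 1ℚ)
      vanish = solve 2 (λ q e₀ → (con 1ℚ :- q) :* con 0ℚ := e₀ :* (con 1ℚ :- con 1ℚ)) refl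
  geometric-sum q q≤1 e decay (suc m) = begin
    (1ℚ - q) * (e 0 + tail)              ≡⟨ *-distribˡ-+ (1ℚ - q) (e 0) tail ⟩
    (1ℚ - q) * e 0 + (1ℚ - q) * tail     ≤⟨ +-monoʳ-≤ ((1ℚ - q) * e 0) tail-bound ⟩
    (1ℚ - q) * e 0 + e 1 * (1ℚ - Q)      ≤⟨ +-monoʳ-≤ ((1ℚ - q) * e 0) head-decay ⟩
    (1ℚ - q) * e 0 + q * e 0 * (1ℚ - Q)  ≡⟨ telescope q (e 0) Q ⟩
    e 0 * (1ℚ - q * Q)                   ∎
    where
      open ≤-Reasoning
      open +-*-Solver
      Q = q ^ℚ m
      tail = sumℚ (λ (j : Fin m) → e (suc (toℕ j)))
      tail-bound : (1ℚ - q) * tail ≤ e 1 * (1ℚ - Q)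
      tail-bound = geometric-sum q q≤1 (λ j → e (suc j)) (λ j → decay (suc j)) m
      head-decay : e 1 * (1ℚ - Q) ≤ q * e 0 * (1ℚ - Q)
      head-decay = *-monoʳ-≤-nonNeg (1ℚ - Q) {{pow-complement-nonNeg q q≤1 m}} (decay 0)
      telescope : ∀ q e₀ Q → (1ℚ - q) * e₀ + q * e₀ * (1ℚ - Q) ≡ e₀ * (1ℚ - q * Q)
      telescope = solve 3 (λ q e₀ Q →
        (con 1ℚ :- q) :* e₀ :+ q :* e₀ :* (con 1ℚ :- Q) := e₀ :* (con 1ℚ :- q :* Q)) refl

  ratio-decay : ∀ r {a b} → suc r ℕ.* a ℕ.≤ r ℕ.* b → ℕ→ℚ a ≤ ratio r * ℕ→ℚ b
  ratio-decay r {a} {b} ra≤rb = *-cancelˡ-≤-pos S {{normalize-pos (suc r) 1}} (begin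
    S * ℕ→ℚ a                ≡⟨ ℕ→ℚ-* (suc r) a ⟨
    ℕ→ℚ (suc r ℕ.* a)        ≤⟨ ℕ→ℚ-mono-≤ ra≤rb ⟩
    ℕ→ℚ (r ℕ.* b)            ≡⟨ ℕ→ℚ-* r b ⟩
    ℕ→ℚ r * ℕ→ℚ b            ≡⟨ cong (_* ℕ→ℚ b) (trans (sym (ratio-* r)) (*-comm (ratio r) S)) ⟩
    S * ratio r * ℕ→ℚ b      ≡⟨ *-assoc S (ratio r) (ℕ→ℚ b) ⟩
    S * (ratio r * ℕ→ℚ b)    ∎)
    where
      open ≤-Reasoning
      S = ℕ→ℚ (suc r)

  denom-unfold : ∀ r t → denom r t ≡ 1ℚ + ℕ→ℚ (2 ℕ.* r ℕ.+ 1) * (1ℚ - ratio r ^ℚ t)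
  denom-unfold r t = begin
    ℕ→ℚ (2 ℕ.* r ℕ.+ 2) - C * Q      ≡⟨ cong (λ k → ℕ→ℚ k - C * Q) (sym (ℕP.+-assoc (2 ℕ.* r) 1 1)) ⟩
    ℕ→ℚ (2 ℕ.* r ℕ.+ 1 ℕ.+ 1) - C * Q ≡⟨ cong (λ x → x - C * Q) (ℕ→ℚ-+ (2 ℕ.* r ℕ.+ 1) 1) ⟩
    C + 1ℚ - C * Q                   ≡⟨ regroup C Q ⟩
    1ℚ + C * (1ℚ - Q)                ∎
    where
      open ≡-Reasoning
      open +-*-Solver
      C = ℕ→ℚ (2 ℕ.* r ℕ.+ 1)
      Q = ratio r ^ℚ t
      regroup : ∀ C Q → C + 1ℚ - C * Q ≡ 1ℚ + C * (1ℚ - Q)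
      regroup = solve 2 (λ C Q → C :+ con 1ℚ :- C :* Q := con 1ℚ :+ C :* (con 1ℚ :- Q)) refl

  denom-pos : ∀ r t → Positive (denom r t)
  denom-pos r t = subst Positive (sym (denom-unfold r t))
    (pos+nonNeg⇒pos 1ℚ (C * (1ℚ - Q))
      {{nonNeg*nonNeg⇒nonNeg C {{ℕ→ℚ-nonNeg (2 ℕ.* r ℕ.+ 1)}} (1ℚ - Q)
          {{pow-complement-nonNeg (ratio r) {{ratio-nonNeg r}} (ratio≤1 r) t}}}})
    where
      C = ℕ→ℚ (2 ℕ.* r ℕ.+ 1)
      Q = ratio r ^ℚ t

  layers-bound : ∀ r t (d : ℕ → ℕ) →
    suc r ℕ.* d 1 ℕ.≤ (2 ℕ.* r ℕ.+ 1) ℕ.* d 0 →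
    (∀ k → suc r ℕ.* d (suc (suc k)) ℕ.≤ r ℕ.* d (suc k)) →
    ℕ→ℚ (sum (λ (i : Fin (suc t)) → d (toℕ i))) ≤ ℕ→ℚ (d 0) * denom r t
  layers-bound r t d first rest = begin
    ℕ→ℚ (sum (λ (i : Fin (suc t)) → d (toℕ i))) ≡⟨ ℕ→ℚ-sum (λ (i : Fin (suc t)) → d (toℕ i)) ⟩
    d₀ + tail                                   ≡⟨ cong (λ x → d₀ + x) (scale tail) ⟩
    d₀ + S * ((1ℚ - ratio r) * tail)            ≤⟨ +-monoʳ-≤ d₀ (*-monoˡ-≤-nonNeg S {{ℕ→ℚ-nonNeg (suc r)}} geometric) ⟩
    d₀ + S * (d₁ * (1ℚ - Q))                    ≡⟨ cong (λ x → d₀ + x) (sym (*-assoc S d₁ (1ℚ - Q))) ⟩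
    d₀ + S * d₁ * (1ℚ - Q)                      ≤⟨ +-monoʳ-≤ d₀ (*-monoʳ-≤-nonNeg (1ℚ - Q) {{Q-nonNeg}} first-ℚ) ⟩
    d₀ + C * d₀ * (1ℚ - Q)                      ≡⟨ factor d₀ C Q ⟩
    d₀ * (1ℚ + C * (1ℚ - Q))                    ≡⟨ cong (d₀ *_) (denom-unfold r t) ⟨
    d₀ * denom r t                              ∎
    where
      open ≤-Reasoning
      open +-*-Solver
      d₀ = ℕ→ℚ (d 0)
      d₁ = ℕ→ℚ (d 1)
      S = ℕ→ℚ (suc r)
      C = ℕ→ℚ (2 ℕ.* r ℕ.+ 1)
      Q = ratio r ^ℚ t
      tail = sumℚ (λ (j : Fin t) → ℕ→ℚ (d (suc (toℕ j))))
      Q-nonNeg : NonNegative (1ℚ - Q)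
      Q-nonNeg = pow-complement-nonNeg (ratio r) {{ratio-nonNeg r}} (ratio≤1 r) t
      scale : ∀ x → x ≡ S * ((1ℚ - ratio r) * x)
      scale x = sym (trans (sym (*-assoc S (1ℚ - ratio r) x))
                           (trans (cong (_* x) (ratio-complement r)) (*-identityˡ x)))
      geometric : (1ℚ - ratio r) * tail ≤ d₁ * (1ℚ - Q)
      geometric = geometric-sum (ratio r) {{ratio-nonNeg r}} (ratio≤1 r) (λ j → ℕ→ℚ (d (suc j)))
                    (λ j → ratio-decay r (rest j)) t
      first-ℚ : S * d₁ ≤ C * d₀
      first-ℚ = subst₂ _≤_ (ℕ→ℚ-* (suc r) (d 1)) (ℕ→ℚ-* (2 ℕ.* r ℕ.+ 1) (d 0)) (ℕ→ℚ-mono-≤ first)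
      factor : ∀ d₀ C Q → d₀ + C * d₀ * (1ℚ - Q) ≡ d₀ * (1ℚ + C * (1ℚ - Q))
      factor = solve 3 (λ d₀ C Q → d₀ :+ C :* d₀ :* (con 1ℚ :- Q) := d₀ :* (con 1ℚ :+ C :* (con 1ℚ :- Q))) refl

  ÷-≤ : ∀ {x y} c .{{_ : Positive c}} → x ≤ y * c → (x ÷ c) {{pos⇒nonZero c}} ≤ y
  ÷-≤ {x} {y} c x≤yc = *-cancelʳ-≤-pos c (subst (_≤ y * c) (sym ÷-*) x≤yc)
    where
      instance
        c≢0 = pos⇒nonZero c
      ÷-* : (x ÷ c) * c ≡ x
      ÷-* = trans (*-assoc x (1/ c) c) (trans (cong (x *_) (*-inverseˡ c)) (*-identityʳ x))

open Counting using (module Layering)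
open Rational using (÷-≤; denom-pos; layers-bound)

theorem4 : (r n t : ℕ) (G : Graph n) (τ : Threshold n) (D : Subset n) →
           MaxDegree≤ G (2 ℕ.* r ℕ.+ 1) →
           (∀ v → suc r ℕ.≤ τ v) →
           IsWDM G τ D t →
           bound n r t ≤ ℕ→ℚ ∣ D ∣
theorem4 r n t G τ D maxdeg thr (L , L≤t , seed , step) =
  ÷-≤ (denom r t) {{denom-pos r t}} n≤|D|·denom
  where
    open Layering G L
    open Decay τ maxdeg thr step
    n≤|D|·denom : ℕ→ℚ n ≤ ℕ→ℚ ∣ D ∣ ℚ.* denom r t
    n≤|D|·denom = subst₂ (λ a b → ℕ→ℚ a ≤ ℕ→ℚ b ℚ.* denom r t)
      (sym (partition L≤t)) (sym (card-seed D seed))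
      (layers-bound r t layerSize decay₀ decay)
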